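{- Let $R,S\in\mathfrak{D}$ and $\mathfrak{D}'\subseteq\mathfrak{D}$, let $\mathcal{E}(R),\mathcal{E}(S)$ be the EV-systems of $R,S$ with respect to $\mathfrak{D}'$, and let $\epsilon:\mathcal{E}(R)\to\mathcal{E}(S)$ be a strict homomorphism. Let $\mathfrak{a}\in\mathcal{E}_o(R)$ satisfy: - $\#\epsilon(\mathfrak{a})_2\le\#\mathfrak{a}_2$ and $\#\epsilon(\mathfrak{a})_3\le\#\mathfrak{a}_3$; - for all $\mathfrak{b},\mathfrak{c}\in N^{in}_{\mathcal{E}(R)}(\mathfrak{a})$, $\epsilon(\mathfrak{b})_1=\epsilon(\mathfrak{c})_1$ implies $\mathfrak{b}_1=\mathfrak{c}_1$; - for all $\mathfrak{b},\mathfrak{c}\in N^{out}_{\mathcal{E}(R)}(\mathfrak{a})$, $\epsilon(\mathfrak{b})_1=\epsilon(\mathfrak{c})_1$ implies $\mathfrak{b}_1=\mathfrak{c}_1$. Then $\alpha^S_{G,\eta_G(\xi)}(v)=\epsilon(\alpha^R_{G,\xi}(v))$ for all $G\in\mathfrak{D}'$, $\xi\in\mathcal{S}(G,R)$ and $v\in V(G)$ with $\alpha^R_{G,\xi}(v)=\mathfrak{a}$. In particular, if these conditions hold for all $\mathfrak{a}\in\mathcal{E}_o(R)$, then $\epsilon$ fulfills Condition 1: $\alpha^S_{G,\eta_G(\xi)}=\epsilon\circ\alpha^R_{G,\xi}$ for all $G\in\mathfrak{D}'$ and $\xi\in\mathcal{S}(G,R)$.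
   Context: Digraphs $G=(V(G),A(G))$ have a finite nonempty vertex set, and $A(G)\subseteq V(G)\times V(G)$; loops are allowed. $N^{in}_G(v)=\{w\ne v: wv\in A(G)\}$ and $N^{out}_G(v)=\{w\ne v:vw\in A(G)\}$. A homomorphism maps arcs to arcs; it is strict if, in addition, it maps proper arcs ($v\ne w$) to proper arcs. $\mathcal{S}(G,H)$ is the set of strict homomorphisms. $\mathfrak{D}$ is a representative system of the isomorphism classes of finite digraphs. EV-system of $T\in\{R,S\}$ with respect to $\mathfrak{D}'$: - Vertex set $\mathcal{E}_o(T)=\{(v,D,U):v\in V(T),\ D\subseteq N^{in}_T(v),\ U\subseteq N^{out}_T(v)\}$, with components $\mathfrak{a}_1,\mathfrak{a}_2,\mathfrak{a}_3$. - $\phi_T(\mathfrak{a})=\mathfrak{a}_1$. - For $G\in\mathfrak{D}'$ and $\xi\in\mathcal{S}(G,T)$, $\alpha^T_{G,\xi}(v)=(\xi(v),\xi[N^{in}_G(v)],\xi[N^{out}_G(v)])$. - $\mathfrak{a}\mathfrak{b}\in A(\mathcal{E}(T))$ iff there exist $G\in\mathfrak{D}'$, $\xi\in\mathcal{S}(G,T)$ and $vw\in A(G)$ with $\mathfrak{a}=\alpha^T_{G,\xi}(v)$ and $\mathfrak{b}=\alpha^T_{G,\xi}(w)$. $\eta_G(\xi):=\phi_S\circ\epsilon\circ\alpha^R_{G,\xi}$ is a strict homomorphism $G\to S$. -}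

module Defs where

open import Data.Nat using (ℕ; zero; suc)
open import Data.Fin using (Fin; zero; suc; _≟_)
open import Data.Fin.Subset using (Subset; _∈_; _⊆_)
open import Data.Bool using (Bool; true; false; _∧_; _∨_; not)
open import Data.Vec using (tabulate; lookup)
open import Data.Vec.Properties using (lookup∘tabulate; []=⇒lookup; lookup⇒[]=)
open import Data.Product using (Σ; ∃; ∃₂; _×_; _,_)
open import Data.Empty using (⊥-elim)
open import Function using (flip; _∘_)
open import Relation.Binary.PropositionalEquality
open import Relation.Nullary using (¬_; yes; no)
open import Relation.Nullary.Decidable using (⌊_⌋)

record Digraph : Set where
  field
    size : ℕ
    arc  : Fin size → Fin size → Bool
open Digraph public

V : Digraph → Set
V G = Fin (size G)

Arc : (G : Digraph) → V G → V G → Set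
Arc G v w = arc G v w ≡ true

nbr : ∀ {n} → (Fin n → Fin n → Bool) → Fin n → Subset n
nbr a v = tabulate λ w → a w v ∧ not ⌊ w ≟ v ⌋

Nin : (G : Digraph) → V G → Subset (size G)
Nin G = nbr (arc G)

Nout : (G : Digraph) → V G → Subset (size G)
Nout G = nbr (flip (arc G))

record IsStrictHom {A B : Set} (ArcA : A → A → Set) (ArcB : B → B → Set)
                   (f : A → B) : Set where
  field
    preserves : ∀ {x y} → ArcA x y → ArcB (f x) (f y)
    strict    : ∀ {x y} → x ≢ y → ArcA x y → f x ≢ f y
open IsStrictHom public

record StrictHom (G H : Digraph) : Set where
  constructor strictHom
  field
    map   : V G → V H
    isSH  : IsStrictHom (Arc G) (Arc H) map
open StrictHom public

anyFin : ∀ {n} → (Fin n → Bool) → Bool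
anyFin {zero}  f = false
anyFin {suc n} f = f zero ∨ anyFin (f ∘ suc)

image : ∀ {n m} → (Fin n → Fin m) → Subset n → Subset m
image f A = tabulate λ y → anyFin λ x → lookup A x ∧ ⌊ f x ≟ y ⌋

private
  anyFin-true : ∀ {n} (f : Fin n → Bool) → anyFin f ≡ true → ∃ λ x → f x ≡ true
  anyFin-true {suc n} f eq with f zero in e
  ... | true  = zero , e
  ... | false with anyFin-true (f ∘ suc) eq
  ... | x , p = suc x , p

  ∧-true : ∀ {a b} → a ∧ b ≡ true → a ≡ true × b ≡ true
  ∧-true {true} {true} _ = refl , refl

  ≟-true : ∀ {n} (x y : Fin n) → ⌊ x ≟ y ⌋ ≡ true → x ≡ y
  ≟-true x y e with x ≟ y
  ... | yes p = p

  not≟-true : ∀ {n} (x y : Fin n) → not ⌊ x ≟ y ⌋ ≡ true → x ≢ y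
  not≟-true x y e with x ≟ y
  ... | no p = p

  ≢-not≟ : ∀ {n} (x y : Fin n) → x ≢ y → not ⌊ x ≟ y ⌋ ≡ true
  ≢-not≟ x y ne with x ≟ y
  ... | yes p = ⊥-elim (ne p)
  ... | no _  = refl

  ∧-intro : ∀ {a b} → a ≡ true → b ≡ true → a ∧ b ≡ true
  ∧-intro refl refl = refl

image-nbr : ∀ {n m} (a : Fin n → Fin n → Bool) (b : Fin m → Fin m → Bool)
  (f : Fin n → Fin m) →
  (∀ {x y} → a x y ≡ true → b (f x) (f y) ≡ true) →
  (∀ {x y} → x ≢ y → a x y ≡ true → f x ≢ f y) →
  ∀ v → image f (nbr a v) ⊆ nbr b (f v)
image-nbr a b f pres str v {x} x∈ with anyFin-true _
  (trans (sym (lookup∘tabulate _ x)) ([]=⇒lookup x∈))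
... | u , p with ∧-true p
... | l , q with ≟-true (f u) x q
... | refl with ∧-true (trans (sym (lookup∘tabulate _ u)) l)
... | auv , neq =
  lookup⇒[]= _ _ (trans (lookup∘tabulate _ (f u))
    (∧-intro (pres auv) (≢-not≟ _ _ (str (not≟-true u v neq) auv))))

-- EV-system vertices E_o(T): triples (v, D, U), D ⊆ N^in(v), U ⊆ N^out(v)
-- (the subset proofs are irrelevant, so equality is equality of triples)

record EV (T : Digraph) : Set where
  constructor ev
  field
    vtx : V T
    D   : Subset (size T)
    U   : Subset (size T)
    .D⊆ : D ⊆ Nin T vtx
    .U⊆ : U ⊆ Nout T vtx
open EV public

φ : {T : Digraph} → EV T → V T
φ = vtx

α : {G T : Digraph} → StrictHom G T → V G → EV T
α {G} {T} ξ v =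
  ev (map ξ v) (image (map ξ) (Nin G v)) (image (map ξ) (Nout G v))
     (image-nbr (arc G) (arc T) (map ξ) (preserves (isSH ξ)) (strict (isSH ξ)) v)
     (image-nbr (flip (arc G)) (flip (arc T)) (map ξ)
        (preserves (isSH ξ)) (λ ne a e → strict (isSH ξ) (ne ∘ sym) a (sym e)) v)

EVArc : (𝔇' : Digraph → Set) (T : Digraph) → EV T → EV T → Set
EVArc 𝔇' T 𝔞 𝔟 = Σ Digraph λ G → 𝔇' G × Σ (StrictHom G T) λ ξ →
  ∃₂ λ v w → Arc G v w × 𝔞 ≡ α ξ v × 𝔟 ≡ α ξ w

NinE : (𝔇' : Digraph → Set) (T : Digraph) → EV T → EV T → Set
NinE 𝔇' T 𝔞 𝔟 = 𝔟 ≢ 𝔞 × EVArc 𝔇' T 𝔟 𝔞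

NoutE : (𝔇' : Digraph → Set) (T : Digraph) → EV T → EV T → Set
NoutE 𝔇' T 𝔞 𝔟 = 𝔟 ≢ 𝔞 × EVArc 𝔇' T 𝔞 𝔟

record EVHom (𝔇' : Digraph → Set) (R S : Digraph) : Set where
  constructor evHom
  field
    fun    : EV R → EV S
    isSHE  : IsStrictHom (EVArc 𝔇' R) (EVArc 𝔇' S) fun
open EVHom public

private
  φ-arc : ∀ {𝔇' S 𝔞 𝔟} → EVArc 𝔇' S 𝔞 𝔟 → Arc S (φ 𝔞) (φ 𝔟)
  φ-arc (G , _ , ζ , x , y , a , refl , refl) = preserves (isSH ζ) a

  φ-strict : ∀ {𝔇' S 𝔞 𝔟} → 𝔞 ≢ 𝔟 → EVArc 𝔇' S 𝔞 𝔟 → φ 𝔞 ≢ φ 𝔟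
  φ-strict ne (G , _ , ζ , x , y , a , refl , refl) with x ≟ y
  ... | yes refl = ⊥-elim (ne refl)
  ... | no x≢y   = strict (isSH ζ) x≢y a

η : ∀ {𝔇' R S} {G : Digraph} → 𝔇' G → EVHom 𝔇' R S → StrictHom G R → StrictHom G S
η {G = G} g ε ξ = strictHom (φ ∘ fun ε ∘ α ξ) record
  { preserves = λ {v} {w} a → φ-arc (preserves (isSHE ε) (G , g , ξ , v , w , a , refl , refl))
  ; strict = λ {v} {w} ne a → φ-strict
      (strict (isSHE ε) (λ e → strict (isSH ξ) ne a (cong vtx e))
                        (G , g , ξ , v , w , a , refl , refl))
      (preserves (isSHE ε) (G , g , ξ , v , w , a , refl , refl))
  }

Condition1 : ∀ {𝔇' R S} → EVHom 𝔇' R S → Set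
Condition1 {𝔇'} {R} {S} ε = ∀ (G : Digraph) (g : 𝔇' G) (ξ : StrictHom G R) (v : V G) →
  α (η g ε ξ) v ≡ fun ε (α ξ v)

open import Data.Nat using (_≤_)
open import Data.Fin.Subset using (∣_∣)

Hyp : ∀ {𝔇' R S} → EVHom 𝔇' R S → EV R → Set
Hyp {𝔇'} {R} ε 𝔞 =
  (∣ D (fun ε 𝔞) ∣ ≤ ∣ D 𝔞 ∣) × (∣ U (fun ε 𝔞) ∣ ≤ ∣ U 𝔞 ∣) ×
  (∀ 𝔟 𝔠 → NinE 𝔇' R 𝔞 𝔟 → NinE 𝔇' R 𝔞 𝔠 →
     vtx (fun ε 𝔟) ≡ vtx (fun ε 𝔠) → vtx 𝔟 ≡ vtx 𝔠) ×
  (∀ 𝔟 𝔠 → NoutE 𝔇' R 𝔞 𝔟 → NoutE 𝔇' R 𝔞 𝔠 →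
     vtx (fun ε 𝔟) ≡ vtx (fun ε 𝔠) → vtx 𝔟 ≡ vtx 𝔠)

{-# OPTIONS --safe #-}
-- Write 𝔞 = α ξ v and h = η g ε ξ = φ ∘ ε ∘ α ξ. For a proper in-neighbour w of v, α ξ w → 𝔞 is a proper
-- arc of 𝓔(R) (ξ is strict), hence ε (α ξ w) → ε 𝔞 is a proper arc of 𝓔(S); such an arc
-- is induced by some strict homomorphism ζ, which places h w in (ε 𝔞)₂. So h[N^in(v)] ⊆ (ε 𝔞)₂.
-- The injectivity hypothesis says that h determines ξ on N^in(v), so
-- #h[N^in(v)] ≥ #ξ[N^in(v)] = #𝔞₂ ≥ #(ε 𝔞)₂, and a subset at least as large as its
-- superset is equal to it.

module Submission where

open import Defs
open import Data.Product using (_×_)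
open import Relation.Binary.PropositionalEquality using (_≡_)

open import Data.Bool using (Bool; true; false; _∧_; not)
open import Data.Fin using (Fin; zero; suc; _≟_)
open import Data.Fin.Subset using (Subset; inside; outside; ⊥; _∈_; _∉_; _⊆_; ∣_∣; ⁅_⁆; _∪_)
open import Data.Fin.Subset.Properties
  using (_∈?_; ⊆-antisym; p⊆q⇒∣p∣≤∣q∣; ∣⊥∣≡0; p⊂q⇒∣p∣<∣q∣; ∪-identityˡ; x∈⁅x⁆; x∈⁅y⁆⇒x≡y; x∈p∪q⁺; x∈p∪q⁻; ∣q∣≤∣p∪q∣)
open import Data.Nat using (_≤_; suc; s≤s; z≤n)
open import Data.Nat.Properties using (≤-refl; ≤-trans; <⇒≱; n≤1+n; module ≤-Reasoning)
open import Data.Product using (∃; _,_)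
open import Data.Sum using (inj₁; inj₂)
open import Data.Vec using ([]; _∷_; tabulate; here; there)
open import Data.Vec.Properties using (lookup∘tabulate; []=⇒lookup; lookup⇒[]=)
open import Function using (_∘_; flip)
open import Relation.Binary.PropositionalEquality using (_≢_; refl; sym; trans; cong; subst)
open import Relation.Nullary using (¬_; Dec; yes; no; contradiction)
open import Relation.Nullary.Decidable using (⌊_⌋; isYes≗does; dec-true; dec-false; decidable-stable)

∧-true⁻ : ∀ {a b} → a ∧ b ≡ true → a ≡ true × b ≡ true
∧-true⁻ {true} {true} _ = refl , refl

∧-true⁺ : ∀ {a b} → a ≡ true → b ≡ true → a ∧ b ≡ true
∧-true⁺ refl refl = refl

⌊⌋-true⁻ : ∀ {A : Set} (a? : Dec A) → ⌊ a? ⌋ ≡ true → A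
⌊⌋-true⁻ (yes a) _ = a

⌊⌋-true⁺ : ∀ {A : Set} (a? : Dec A) → A → ⌊ a? ⌋ ≡ true
⌊⌋-true⁺ a? a = trans (isYes≗does a?) (dec-true a? a)

not⌊⌋-true⁻ : ∀ {A : Set} (a? : Dec A) → not ⌊ a? ⌋ ≡ true → ¬ A
not⌊⌋-true⁻ (no ¬a) _ = ¬a

not⌊⌋-true⁺ : ∀ {A : Set} (a? : Dec A) → ¬ A → not ⌊ a? ⌋ ≡ true
not⌊⌋-true⁺ a? ¬a = cong not (trans (isYes≗does a?) (dec-false a? ¬a))

anyFin⁻ : ∀ {n} (p : Fin n → Bool) → anyFin p ≡ true → ∃ λ x → p x ≡ true
anyFin⁻ {suc n} p any with p zero in p0
... | true  = zero , p0
... | false with anyFin⁻ (p ∘ suc) any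
...   | x , px = suc x , px

anyFin⁺ : ∀ {n} (p : Fin n → Bool) x → p x ≡ true → anyFin p ≡ true
anyFin⁺ p zero    px rewrite px = refl
anyFin⁺ p (suc x) px with p zero
... | true  = refl
... | false = anyFin⁺ (p ∘ suc) x px

∈-tabulate⁻ : ∀ {n} (p : Fin n → Bool) {x} → x ∈ tabulate p → p x ≡ true
∈-tabulate⁻ p {x} x∈ = trans (sym (lookup∘tabulate p x)) ([]=⇒lookup x∈)

∈-tabulate⁺ : ∀ {n} (p : Fin n → Bool) {x} → p x ≡ true → x ∈ tabulate p
∈-tabulate⁺ p {x} px = lookup⇒[]= x _ (trans (lookup∘tabulate p x) px)

∈-image⁻ : ∀ {n m} (f : Fin n → Fin m) {A y} → y ∈ image f A → ∃ λ x → x ∈ A × f x ≡ y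
∈-image⁻ f {A} {y} y∈ with anyFin⁻ _ (∈-tabulate⁻ _ y∈)
... | x , px with ∧-true⁻ px
...   | x∈A , fx≡y = x , lookup⇒[]= x A x∈A , ⌊⌋-true⁻ (f x ≟ y) fx≡y

∈-image⁺ : ∀ {n m} (f : Fin n → Fin m) {A x} → x ∈ A → f x ∈ image f A
∈-image⁺ f {A} {x} x∈A =
  ∈-tabulate⁺ _ (anyFin⁺ _ x (∧-true⁺ ([]=⇒lookup x∈A) (⌊⌋-true⁺ (f x ≟ f x) refl)))

image-⊆ : ∀ {n m} (f : Fin n → Fin m) {A P} → (∀ {x} → x ∈ A → f x ∈ P) → image f A ⊆ P
image-⊆ f f[A]⊆P y∈ with ∈-image⁻ f y∈
... | x , x∈A , refl = f[A]⊆P x∈A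

image-inside∷ : ∀ {n m} (f : Fin (suc n) → Fin m) A →
  image f (inside ∷ A) ≡ ⁅ f zero ⁆ ∪ image (f ∘ suc) A
image-inside∷ f A = ⊆-antisym into onto
  where
  into : image f (inside ∷ A) ⊆ ⁅ f zero ⁆ ∪ image (f ∘ suc) A
  into y∈ with ∈-image⁻ f {inside ∷ A} y∈
  ... | zero  , _          , refl = x∈p∪q⁺ (inj₁ (x∈⁅x⁆ (f zero)))
  ... | suc x , there x∈A , refl = x∈p∪q⁺ (inj₂ (∈-image⁺ (f ∘ suc) {A} x∈A))
  onto : ⁅ f zero ⁆ ∪ image (f ∘ suc) A ⊆ image f (inside ∷ A)
  onto y∈ with x∈p∪q⁻ ⁅ f zero ⁆ _ y∈
  ... | inj₁ y∈⁅f0⁆ rewrite x∈⁅y⁆⇒x≡y (f zero) y∈⁅f0⁆ = ∈-image⁺ f {inside ∷ A} here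
  ... | inj₂ y∈f[A] with ∈-image⁻ (f ∘ suc) {A} y∈f[A]
  ...   | x , x∈A , refl = ∈-image⁺ f {inside ∷ A} (there x∈A)

p⊆q∧∣q∣≤∣p∣⇒p≡q : ∀ {n} {p q : Subset n} → p ⊆ q → ∣ q ∣ ≤ ∣ p ∣ → p ≡ q
p⊆q∧∣q∣≤∣p∣⇒p≡q {p = p} {q} p⊆q ∣q∣≤∣p∣ = ⊆-antisym p⊆q q⊆p
  where
  q⊆p : q ⊆ p
  q⊆p {x} x∈q = decidable-stable (x ∈? p) λ x∉p →
    <⇒≱ (p⊂q⇒∣p∣<∣q∣ (p⊆q , x , x∈q , x∉p)) ∣q∣≤∣p∣

x∈p⇒⁅x⁆∪p≡p : ∀ {n} {x : Fin n} {p} → x ∈ p → ⁅ x ⁆ ∪ p ≡ p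
x∈p⇒⁅x⁆∪p≡p {p = _ ∷ p} here        = cong (inside ∷_) (∪-identityˡ p)
x∈p⇒⁅x⁆∪p≡p {p = s ∷ _} (there x∈p) = cong (s ∷_) (x∈p⇒⁅x⁆∪p≡p x∈p)

x∉p⇒∣⁅x⁆∪p∣≡1+∣p∣ : ∀ {n} {x : Fin n} {p} → x ∉ p → ∣ ⁅ x ⁆ ∪ p ∣ ≡ suc ∣ p ∣
x∉p⇒∣⁅x⁆∪p∣≡1+∣p∣ {x = zero}  {outside ∷ p} _   = cong (suc ∘ ∣_∣) (∪-identityˡ p)
x∉p⇒∣⁅x⁆∪p∣≡1+∣p∣ {x = zero}  {inside  ∷ p} x∉p = contradiction here x∉p
x∉p⇒∣⁅x⁆∪p∣≡1+∣p∣ {x = suc x} {outside ∷ p} x∉p = x∉p⇒∣⁅x⁆∪p∣≡1+∣p∣ (x∉p ∘ there)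
x∉p⇒∣⁅x⁆∪p∣≡1+∣p∣ {x = suc x} {inside  ∷ p} x∉p = cong suc (x∉p⇒∣⁅x⁆∪p∣≡1+∣p∣ (x∉p ∘ there))

∣⁅x⁆∪p∣≤1+∣p∣ : ∀ {n} (x : Fin n) p → ∣ ⁅ x ⁆ ∪ p ∣ ≤ suc ∣ p ∣
∣⁅x⁆∪p∣≤1+∣p∣ x p with x ∈? p
... | yes x∈p rewrite x∈p⇒⁅x⁆∪p≡p x∈p = n≤1+n ∣ p ∣
... | no  x∉p rewrite x∉p⇒∣⁅x⁆∪p∣≡1+∣p∣ x∉p = ≤-refl

∣⁅x⁆∪p∣-mono : ∀ {n m} {p : Subset n} {q : Subset m} x y →
  (y ∈ q → x ∈ p) → ∣ p ∣ ≤ ∣ q ∣ → ∣ ⁅ x ⁆ ∪ p ∣ ≤ ∣ ⁅ y ⁆ ∪ q ∣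
∣⁅x⁆∪p∣-mono {p = p} {q} x y y∈q⇒x∈p ∣p∣≤∣q∣ with y ∈? q
... | yes y∈q = begin
  ∣ ⁅ x ⁆ ∪ p ∣ ≡⟨ cong ∣_∣ (x∈p⇒⁅x⁆∪p≡p (y∈q⇒x∈p y∈q)) ⟩
  ∣ p ∣         ≤⟨ ∣p∣≤∣q∣ ⟩
  ∣ q ∣         ≤⟨ ∣q∣≤∣p∪q∣ ⁅ y ⁆ q ⟩
  ∣ ⁅ y ⁆ ∪ q ∣ ∎
  where open ≤-Reasoning
... | no y∉q = begin
  ∣ ⁅ x ⁆ ∪ p ∣ ≤⟨ ∣⁅x⁆∪p∣≤1+∣p∣ x p ⟩
  suc ∣ p ∣     ≤⟨ s≤s ∣p∣≤∣q∣ ⟩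
  suc ∣ q ∣     ≡⟨ x∉p⇒∣⁅x⁆∪p∣≡1+∣p∣ y∉q ⟨
  ∣ ⁅ y ⁆ ∪ q ∣ ∎
  where open ≤-Reasoning

Determines : ∀ {n k m} → (Fin n → Fin k) → (Fin n → Fin m) → Subset n → Set
Determines h f A = ∀ {x y} → x ∈ A → y ∈ A → h x ≡ h y → f x ≡ f y

∣image∣-mono : ∀ {n k m} {h : Fin n → Fin k} {f : Fin n → Fin m} A →
  Determines h f A → ∣ image f A ∣ ≤ ∣ image h A ∣
∣image∣-mono {m = m} {h} {f} [] _ = begin
  ∣ image f [] ∣ ≤⟨ p⊆q⇒∣p∣≤∣q∣ (image-⊆ f {[]} {⊥} λ ()) ⟩
  ∣ ⊥ {m} ∣      ≡⟨ ∣⊥∣≡0 m ⟩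
  0              ≤⟨ z≤n ⟩
  ∣ image h [] ∣ ∎
  where open ≤-Reasoning
∣image∣-mono (outside ∷ A) h⇒f = ∣image∣-mono A λ x∈ y∈ → h⇒f (there x∈) (there y∈)
∣image∣-mono {h = h} {f} (inside ∷ A) h⇒f rewrite image-inside∷ f A | image-inside∷ h A =
  ∣⁅x⁆∪p∣-mono (f zero) (h zero) h0∈⇒f0∈
    (∣image∣-mono A λ x∈ y∈ → h⇒f (there x∈) (there y∈))
  where
  h0∈⇒f0∈ : h zero ∈ image (h ∘ suc) A → f zero ∈ image (f ∘ suc) A
  h0∈⇒f0∈ h0∈ with ∈-image⁻ (h ∘ suc) {A} h0∈
  ... | x , x∈A , hx≡h0 =
    subst (_∈ image (f ∘ suc) A) (h⇒f (there x∈A) here hx≡h0) (∈-image⁺ (f ∘ suc) x∈A)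

image-≡-by-∣∣ : ∀ {n k m} {h : Fin n → Fin k} {f : Fin n → Fin m} {A P} →
  image h A ⊆ P → ∣ P ∣ ≤ ∣ image f A ∣ → Determines h f A → image h A ≡ P
image-≡-by-∣∣ {A = A} h[A]⊆P ∣P∣≤ h⇒f = p⊆q∧∣q∣≤∣p∣⇒p≡q h[A]⊆P (≤-trans ∣P∣≤ (∣image∣-mono A h⇒f))

∈-nbr⁻ : ∀ {n} (a : Fin n → Fin n → Bool) {v w} → w ∈ nbr a v → a w v ≡ true × w ≢ v
∈-nbr⁻ a {v} {w} w∈ with ∧-true⁻ (∈-tabulate⁻ _ w∈)
... | awv , w≢v = awv , not⌊⌋-true⁻ (w ≟ v) w≢v

∈-nbr⁺ : ∀ {n} (a : Fin n → Fin n → Bool) {v w} → a w v ≡ true → w ≢ v → w ∈ nbr a v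
∈-nbr⁺ a {v} {w} awv w≢v = ∈-tabulate⁺ _ (∧-true⁺ awv (not⌊⌋-true⁺ (w ≟ v) w≢v))

ev-≡ : ∀ {T} (𝔟 : EV T) {x P Q} .{P⊆ : P ⊆ Nin T x} .{Q⊆ : Q ⊆ Nout T x} →
  x ≡ vtx 𝔟 → P ≡ D 𝔟 → Q ≡ U 𝔟 → ev x P Q P⊆ Q⊆ ≡ 𝔟
ev-≡ _ refl refl refl = refl

module _ {𝔇' : Digraph → Set} where

  α-Nin : ∀ {G T} → 𝔇' G → (ξ : StrictHom G T) → ∀ {v w} →
    w ∈ Nin G v → NinE 𝔇' T (α ξ v) (α ξ w)
  α-Nin {G} g ξ {v} {w} w∈ with ∈-nbr⁻ (arc G) w∈
  ... | awv , w≢v =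
    strict (isSH ξ) w≢v awv ∘ cong vtx , G , g , ξ , w , v , awv , refl , refl

  α-Nout : ∀ {G T} → 𝔇' G → (ξ : StrictHom G T) → ∀ {v w} →
    w ∈ Nout G v → NoutE 𝔇' T (α ξ v) (α ξ w)
  α-Nout {G} g ξ {v} {w} w∈ with ∈-nbr⁻ (flip (arc G)) w∈
  ... | avw , w≢v =
    strict (isSH ξ) (w≢v ∘ sym) avw ∘ cong vtx ∘ sym , G , g , ξ , v , w , avw , refl , refl

  NinE⇒vtx∈D : ∀ {T 𝔞 𝔟} → NinE 𝔇' T 𝔞 𝔟 → vtx 𝔟 ∈ D 𝔞
  NinE⇒vtx∈D (𝔟≢𝔞 , G , _ , ζ , x , y , axy , refl , refl) =
    ∈-image⁺ (map ζ) (∈-nbr⁺ (arc G) axy (𝔟≢𝔞 ∘ cong (α ζ)))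

  NoutE⇒vtx∈U : ∀ {T 𝔞 𝔟} → NoutE 𝔇' T 𝔞 𝔟 → vtx 𝔟 ∈ U 𝔞
  NoutE⇒vtx∈U (𝔟≢𝔞 , G , _ , ζ , x , y , axy , refl , refl) =
    ∈-image⁺ (map ζ) (∈-nbr⁺ (flip (arc G)) axy (𝔟≢𝔞 ∘ cong (α ζ)))

  fun-NinE : ∀ {R S} (ε : EVHom 𝔇' R S) {𝔞 𝔟} →
    NinE 𝔇' R 𝔞 𝔟 → NinE 𝔇' S (fun ε 𝔞) (fun ε 𝔟)
  fun-NinE ε (𝔟≢𝔞 , 𝔟→𝔞) = strict (isSHE ε) 𝔟≢𝔞 𝔟→𝔞 , preserves (isSHE ε) 𝔟→𝔞

  fun-NoutE : ∀ {R S} (ε : EVHom 𝔇' R S) {𝔞 𝔟} →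
    NoutE 𝔇' R 𝔞 𝔟 → NoutE 𝔇' S (fun ε 𝔞) (fun ε 𝔟)
  fun-NoutE ε (𝔟≢𝔞 , 𝔞→𝔟) = strict (isSHE ε) (𝔟≢𝔞 ∘ sym) 𝔞→𝔟 ∘ sym , preserves (isSHE ε) 𝔞→𝔟

  α-η-≡ : ∀ {R S} (ε : EVHom 𝔇' R S) (𝔞 : EV R) → Hyp ε 𝔞 →
    ∀ (G : Digraph) (g : 𝔇' G) (ξ : StrictHom G R) (v : V G) →
    α ξ v ≡ 𝔞 → α (η g ε ξ) v ≡ fun ε (α ξ v)
  α-η-≡ {S = S} ε _ (∣D∣≤ , ∣U∣≤ , Nin-inj , Nout-inj) G g ξ v refl =
    ev-≡ (fun ε (α ξ v)) refl
      (image-≡-by-∣∣ (image-⊆ h (NinE⇒vtx∈D ∘ fun-NinE ε ∘ α-Nin g ξ)) ∣D∣≤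
        λ x∈ y∈ → Nin-inj _ _ (α-Nin g ξ x∈) (α-Nin g ξ y∈))
      (image-≡-by-∣∣ (image-⊆ h (NoutE⇒vtx∈U ∘ fun-NoutE ε ∘ α-Nout g ξ)) ∣U∣≤
        λ x∈ y∈ → Nout-inj _ _ (α-Nout g ξ x∈) (α-Nout g ξ y∈))
    where
    h : V G → V S
    h = map (η g ε ξ)

proposition5 : (𝔇' : Digraph → Set) (R S : Digraph) (ε : EVHom 𝔇' R S) →
    ((𝔞 : EV R) → Hyp ε 𝔞 →
      ∀ (G : Digraph) (g : 𝔇' G) (ξ : StrictHom G R) (v : V G) →
        α ξ v ≡ 𝔞 → α (η g ε ξ) v ≡ fun ε (α ξ v))
    × (((𝔞 : EV R) → Hyp ε 𝔞) → Condition1 ε)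
proposition5 𝔇' R S ε =
  α-η-≡ ε , λ hyp G g ξ v → α-η-≡ ε (α ξ v) (hyp (α ξ v)) G g ξ v refl
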